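{- Let $p\geq 1$ be an integer and let $T$ denote the map on odd positive integers $T(n)=(3n+1)/2^{\nu}$, where $2^\nu$ is the largest power of $2$ dividing $3n+1$. Starting from $n_0=2^{p+1}-1$, define $n_{i}=T(n_{i-1})$ for $i=1,\dots,p$. Then for each $i=1,\dots,p$ the largest power of $2$ dividing $3n_{i-1}+1$ is exactly $2^1$, and $n_p=2\cdot 3^{p}-1$.
   Context: In the paper's polynomial notation ($x\equiv 2$), $2^{p+1}-1=F^{(p-1)}_p(x)=x^p+x^{p-1}+\cdots+x+1$ and the claim reads $C_1^{(p)}[F^{(p-1)}_p(x)]=x(x+1)^p-1$, where $C_1^{(p)}$ denotes $p$ successive Collatz operations each dividing by $x^1=2$. -}

module Defs where

open import Data.Nat using (ℕ; zero; suc; _+_; _*_; _^_; _/_; _%_; _≡ᵇ_)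
open import Data.Nat.Properties using (m^n≢0)
open import Data.Nat.Divisibility using (_∣_)
open import Data.Bool using (if_then_else_)
open import Data.Product using (_×_)
open import Relation.Nullary using (¬_)

-- ν₂-fuel f m: number of times 2 divides m, with recursion fuel f.
-- With fuel ≥ m and m > 0 this is exactly the 2-adic valuation of m.
ν₂-fuel : ℕ → ℕ → ℕ
ν₂-fuel zero    m = zero
ν₂-fuel (suc f) zero = zero
ν₂-fuel (suc f) (suc m) =
  if (suc m % 2) ≡ᵇ 0 then suc (ν₂-fuel f (suc m / 2)) else zero

ν₂ : ℕ → ℕ
ν₂ m = ν₂-fuel m m

T : ℕ → ℕ
T n = _/_ (3 * n + 1) (2 ^ ν₂ (3 * n + 1)) {{m^n≢0 2 (ν₂ (3 * n + 1))}}

T^[_] : ℕ → ℕ → ℕ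
T^[ zero ] n = n
T^[ suc i ] n = T (T^[ i ] n)

_∥₂_ : ℕ → ℕ → Set
k ∥₂ m = (2 ^ k ∣ m) × ¬ (2 ^ suc k ∣ m)

module Submission where

-- Every iterate is one less than a multiple of 4 until the very
-- last step: the orbit of  2^(p+1) - 1  is  2·2^j·3^i - 1  with  i + j = p.
-- For a number  n = 4N - 1  (N ≥ 1) we have  3n + 1 = 2·(6N - 1)  with
-- 6N - 1 odd, so exactly one factor 2 is removed and  T(4N - 1) = 6N - 1,
-- i.e. one step trades a factor 2 of  n + 1  for a factor 3.

open import Defs
open import Data.Nat using (ℕ; zero; suc; _+_; _*_; _∸_; _^_; _≤_; _%_; _/_; NonZero)
open import Data.Nat.Properties
  using (*-comm; +-comm; +-suc; +-identityʳ; *-identityˡ; *-identityʳ; ^-distribˡ-+-*; m+[n∸m]≡n; m*n≢0; m^n≢0)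
open import Data.Nat.DivMod using (m*n%n≡0; m*n/n≡m; [m+kn]%n≡m%n)
open import Data.Nat.Divisibility using (_∣_; divides; *-cancelˡ-∣; ∣m+n∣m⇒∣n; m∣m*n; ∣1⇒≡1)
open import Data.Nat.Tactic.RingSolver using (solve-∀)
open import Data.Product using (_×_; _,_)
open import Relation.Binary.PropositionalEquality
open import Relation.Nullary using (¬_)

open ≡-Reasoning

ν₂-fuel-even : ∀ f m → suc m % 2 ≡ 0 →
  ν₂-fuel (suc f) (suc m) ≡ suc (ν₂-fuel f (suc m / 2))
ν₂-fuel-even f m even rewrite even = refl

odd-mod-2 : ∀ q → (1 + 2 * q) % 2 ≡ 1
odd-mod-2 q = trans (cong (λ x → (1 + x) % 2) (*-comm 2 q)) ([m+kn]%n≡m%n 1 q 2)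

ν₂-fuel-odd : ∀ f q → ν₂-fuel f (1 + 2 * q) ≡ 0
ν₂-fuel-odd zero    q = refl
ν₂-fuel-odd (suc f) q rewrite odd-mod-2 q = refl

ν₂-twice-odd : ∀ q → ν₂ (2 * (1 + 2 * q)) ≡ 1
ν₂-twice-odd q = begin
    ν₂-fuel (suc f) (2 * m)
  ≡⟨ ν₂-fuel-even f f (trans (cong (_% 2) (*-comm 2 m)) (m*n%n≡0 m 2)) ⟩
    suc (ν₂-fuel f (2 * m / 2))
  ≡⟨ cong (λ x → suc (ν₂-fuel f x)) (trans (cong (_/ 2) (*-comm 2 m)) (m*n/n≡m m 2)) ⟩
    suc (ν₂-fuel f m)
  ≡⟨ cong suc (ν₂-fuel-odd f q) ⟩
    1 ∎
  where
  m : ℕ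
  m = 1 + 2 * q
  -- 2 * m  computes to  suc f,  so the fuel  ν₂  supplies is  suc f.
  f : ℕ
  f = 2 * q + (m + 0)

exactly-one-two-twice-odd : ∀ q → 1 ∥₂ (2 * (1 + 2 * q))
exactly-one-two-twice-odd q = divides (1 + 2 * q) (*-comm 2 (1 + 2 * q)) , not-by-4
  where
  not-by-4 : ¬ (2 ^ 2 ∣ 2 * (1 + 2 * q))
  not-by-4 4∣ = two≢one (∣1⇒≡1 (∣m+n∣m⇒∣n 2∣2q+1 (m∣m*n q)))
    where
    2∣2q+1 : 2 ∣ 2 * q + 1
    2∣2q+1 = subst (2 ∣_) (+-comm 1 (2 * q)) (*-cancelˡ-∣ {m = 2} {n = 1 + 2 * q} 2 4∣)
    two≢one : ¬ (2 ≡ 1)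
    two≢one ()

T-twice-odd : ∀ n q → 3 * n + 1 ≡ 2 * (1 + 2 * q) → T n ≡ 1 + 2 * q
T-twice-odd n q eq rewrite eq | ν₂-twice-odd q =
  trans (cong (_/ 2) (*-comm 2 (1 + 2 * q))) (m*n/n≡m (1 + 2 * q) 2)

four-times-suc : ∀ M → 4 * suc M ≡ suc (4 * M + 3)
four-times-suc = solve-∀

six-times-suc : ∀ M → 6 * suc M ≡ suc (1 + 2 * (3 * M + 2))
six-times-suc = solve-∀

three-mod-four-image : ∀ M → 3 * (4 * M + 3) + 1 ≡ 2 * (1 + 2 * (3 * M + 2))
three-mod-four-image = solve-∀

T-step : ∀ N .{{_ : NonZero N}} → T (4 * N ∸ 1) ≡ 6 * N ∸ 1
T-step (suc M) = begin
    T (4 * suc M ∸ 1)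
  ≡⟨ cong (λ x → T (x ∸ 1)) (four-times-suc M) ⟩
    T (4 * M + 3)
  ≡⟨ T-twice-odd (4 * M + 3) (3 * M + 2) (three-mod-four-image M) ⟩
    1 + 2 * (3 * M + 2)
  ≡⟨ cong (_∸ 1) (sym (six-times-suc M)) ⟩
    6 * suc M ∸ 1 ∎

exactly-one-two-step : ∀ N .{{_ : NonZero N}} → 1 ∥₂ (3 * (4 * N ∸ 1) + 1)
exactly-one-two-step (suc M) =
  subst (λ x → 1 ∥₂ (3 * (x ∸ 1) + 1)) (sym (four-times-suc M))
    (subst (1 ∥₂_) (sym (three-mod-four-image M)) (exactly-one-two-twice-odd (3 * M + 2)))

double-shift : ∀ a b → 2 * (2 * a * b) ≡ 4 * (a * b)
double-shift = solve-∀

triple-shift : ∀ a b → 6 * (a * b) ≡ 2 * (a * (3 * b))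
triple-shift = solve-∀

orbit-factor≢0 : ∀ j i → NonZero (2 ^ j * 3 ^ i)
orbit-factor≢0 j i = m*n≢0 (2 ^ j) (3 ^ i) {{m^n≢0 2 j}} {{m^n≢0 3 i}}

orbit : ∀ i j → T^[ i ] (2 * 2 ^ (i + j) ∸ 1) ≡ 2 * (2 ^ j * 3 ^ i) ∸ 1
orbit zero    j = cong (λ x → 2 * x ∸ 1) (sym (*-identityʳ (2 ^ j)))
orbit (suc i) j = begin
    T (T^[ i ] (2 * 2 ^ suc (i + j) ∸ 1))
  ≡⟨ cong (λ k → T (T^[ i ] (2 * 2 ^ k ∸ 1))) (sym (+-suc i j)) ⟩
    T (T^[ i ] (2 * 2 ^ (i + suc j) ∸ 1))
  ≡⟨ cong T (orbit i (suc j)) ⟩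
    T (2 * (2 * 2 ^ j * 3 ^ i) ∸ 1)
  ≡⟨ cong (λ x → T (x ∸ 1)) (double-shift (2 ^ j) (3 ^ i)) ⟩
    T (4 * N ∸ 1)
  ≡⟨ T-step N ⟩
    6 * N ∸ 1
  ≡⟨ cong (_∸ 1) (triple-shift (2 ^ j) (3 ^ i)) ⟩
    2 * (2 ^ j * 3 ^ suc i) ∸ 1 ∎
  where
  N : ℕ
  N = 2 ^ j * 3 ^ i
  instance
    N≢0 : NonZero N
    N≢0 = orbit-factor≢0 j i

start-point : ∀ {p m} → m ≡ p → 2 ^ (p + 1) ∸ 1 ≡ 2 * 2 ^ m ∸ 1
start-point {p} refl = cong (_∸ 1) (trans (^-distribˡ-+-* 2 p 1) (*-comm (2 ^ p) 2))

-- Steps 1, …, p each divide by exactly 2 since the (i-1)-st iterate is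
-- 4·2^(p-i)·3^(i-1) - 1;  the p-th iterate is  2·3^p - 1.
mainTheorem3 : (p : ℕ) → 1 ≤ p →
    ((i : ℕ) → 1 ≤ i → i ≤ p →
      1 ∥₂ (3 * T^[ i ∸ 1 ] (2 ^ (p + 1) ∸ 1) + 1))
    × (T^[ p ] (2 ^ (p + 1) ∸ 1) ≡ 2 * 3 ^ p ∸ 1)
mainTheorem3 p _ = exact-division , final-value
  where
  exact-division : (i : ℕ) → 1 ≤ i → i ≤ p →
    1 ∥₂ (3 * T^[ i ∸ 1 ] (2 ^ (p + 1) ∸ 1) + 1)
  exact-division zero    ()
  exact-division (suc i) _ i<p =
    subst (λ n → 1 ∥₂ (3 * n + 1)) (sym iterate) (exactly-one-two-step N {{orbit-factor≢0 j i}})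
    where
    j : ℕ
    j = p ∸ suc i
    N : ℕ
    N = 2 ^ j * 3 ^ i
    iterate : T^[ i ] (2 ^ (p + 1) ∸ 1) ≡ 4 * N ∸ 1
    iterate = begin
        T^[ i ] (2 ^ (p + 1) ∸ 1)
      ≡⟨ cong T^[ i ] (start-point (trans (+-suc i j) (m+[n∸m]≡n i<p))) ⟩
        T^[ i ] (2 * 2 ^ (i + suc j) ∸ 1)
      ≡⟨ orbit i (suc j) ⟩
        2 * (2 * 2 ^ j * 3 ^ i) ∸ 1
      ≡⟨ cong (_∸ 1) (double-shift (2 ^ j) (3 ^ i)) ⟩
        4 * N ∸ 1 ∎
  final-value : T^[ p ] (2 ^ (p + 1) ∸ 1) ≡ 2 * 3 ^ p ∸ 1
  final-value = begin
      T^[ p ] (2 ^ (p + 1) ∸ 1)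
    ≡⟨ cong T^[ p ] (start-point (+-identityʳ p)) ⟩
      T^[ p ] (2 * 2 ^ (p + 0) ∸ 1)
    ≡⟨ orbit p 0 ⟩
      2 * (1 * 3 ^ p) ∸ 1
    ≡⟨ cong (λ x → 2 * x ∸ 1) (*-identityˡ (3 ^ p)) ⟩
      2 * 3 ^ p ∸ 1 ∎
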